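{- Let $z,m,r,x$ be the functions on positive integers defined in the context. (i) If $a,b,n$ are positive integers with $a\le n\le b$, then $z(a)-(r(b)+1)m(b)\le x(n)\le z(b)-(r(a)+1)m(a)$. (ii) Let $a$ be a positive integer with $x(a)<0$, and let $b$ be the largest integer such that $2b\le 3(r(a)+1)m(a)$. Then $x(n)<0$ for every positive integer $n$ with $a\le n\le b$. (iii) Let $b$ be a positive integer with $x(b)>0$, and let $a$ be the least integer such that $2a\ge 3(r(b)+1)m(b)+4$. Then $x(n)>0$ for every positive integer $n$ with $a\le n\le b$.
   Context: For a positive integer $n$: $z(n)$ denotes the largest integer such that $3z(n)<2n$; $m(n)$ denotes the largest integer such that $m(n)^2\le 2n$; $r(n)$ denotes the least non-negative integer such that $n\le 2^{r(n)}$; and $x(n)=z(n)-(r(n)+1)m(n)$. -}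

module Defs where

open import Data.Nat using (ℕ; zero; suc; _+_; _*_; _^_; _<ᵇ_; _≤ᵇ_)
open import Data.Bool using (Bool; if_then_else_)
open import Data.Integer as ℤ using (ℤ; +_)

-- largestUpTo P B : the largest k ≤ B with P k (0 if none).
largestUpTo : (ℕ → Bool) → ℕ → ℕ
largestUpTo P zero    = zero
largestUpTo P (suc b) = if P (suc b) then suc b else largestUpTo P b

-- leastIn P k f : the least j ∈ [k, k+f] with P j (k+f if none).
leastIn : (ℕ → Bool) → ℕ → ℕ → ℕ
leastIn P k zero    = k
leastIn P k (suc f) = if P k then k else leastIn P (suc k) f

-- z(n): largest integer z with 3z < 2n  (any such z ≥ 0 satisfies z ≤ 2n).
z : ℕ → ℕ
z n = largestUpTo (λ k → 3 * k <ᵇ 2 * n) (2 * n)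

-- m(n): largest integer m with m² ≤ 2n  (m ≥ 0 w.l.o.g.; such m satisfy m ≤ 2n).
m : ℕ → ℕ
m n = largestUpTo (λ k → k * k ≤ᵇ 2 * n) (2 * n)

-- r(n): least non-negative integer r with n ≤ 2^r  (r = n always works).
r : ℕ → ℕ
r n = leastIn (λ k → n ≤ᵇ 2 ^ k) 0 n

x : ℕ → ℤ
x n = + z n ℤ.- (+ (r n + 1) ℤ.* + m n)

-- Each of z, m and r is non-decreasing, so x(n) = z(n) − (r(n)+1)m(n) is squeezed
-- between z(a) − (r(b)+1)m(b) and z(b) − (r(a)+1)m(a) on [a, b]; this is (i).
-- In (ii), 3z(b) < 2b ≤ 3(r(a)+1)m(a) makes the upper bound negative; in (iii),
-- 3((r(b)+1)m(b) + 1) < 2a makes the lower bound positive.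
module Submission where

open import Defs
open import Data.Nat using (ℕ; _+_; _*_; _≤_)
open import Data.Integer as ℤ using (ℤ; +_; _-_; 0ℤ)
open import Data.Product using (_×_)

open import Data.Bool using (Bool; true; false; T)
open import Data.Empty using (⊥-elim)
open import Function using (_∘′_)
open import Data.Integer.Properties as ℤ using (pos-*)
open import Data.Nat as ℕ using (zero; suc; _<_; z≤n; s≤s; _^_)
open import Data.Nat.Properties
open import Data.Nat.Solver using (module +-*-Solver)
open import Data.Product using (_,_)
open import Data.Sum using (inj₁; inj₂)
open import Data.Unit using (tt)
open import Relation.Binary.PropositionalEquality

largestUpTo-maximal : ∀ P B {k} → k ≤ B → T (P k) → k ≤ largestUpTo P B
largestUpTo-maximal P zero    z≤n _ = z≤n
largestUpTo-maximal P (suc B) k≤1+B pk with P (suc B) in eq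
... | true = k≤1+B
... | false with m≤n⇒m<n∨m≡n k≤1+B
...   | inj₁ (s≤s k≤B) = largestUpTo-maximal P B k≤B pk
...   | inj₂ refl rewrite eq = ⊥-elim pk

largestUpTo-satisfies : ∀ (P : ℕ → Bool) B → T (P 0) → T (P (largestUpTo P B))
largestUpTo-satisfies P zero    p0 = p0
largestUpTo-satisfies P (suc B) p0 with P (suc B) in eq
... | true rewrite eq = tt
... | false = largestUpTo-satisfies P B p0

largestUpTo-mono : ∀ P Q {B B′} → (∀ k → T (P k) → T (Q k)) → B ≤ B′ →
                   largestUpTo P B ≤ largestUpTo Q B′
largestUpTo-mono P Q {zero}  P⇒Q B≤B′ = z≤n
largestUpTo-mono P Q {suc B} P⇒Q B≤B′ with P (suc B) in eq
... | true  = largestUpTo-maximal Q _ B≤B′ (P⇒Q (suc B) (subst T (sym eq) tt))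
... | false = largestUpTo-mono P Q P⇒Q (≤-trans (n≤1+n B) B≤B′)

leastIn-minimal : ∀ P k f {j} → k ≤ j → T (P j) → leastIn P k f ≤ j
leastIn-minimal P k zero    k≤j _ = k≤j
leastIn-minimal P k (suc f) k≤j pj with P k in eq
... | true = k≤j
... | false with m≤n⇒m<n∨m≡n k≤j
...   | inj₁ k<j = leastIn-minimal P (suc k) f k<j pj
...   | inj₂ refl rewrite eq = ⊥-elim pj

leastIn-satisfies : ∀ (P : ℕ → Bool) k f → T (P (k + f)) → T (P (leastIn P k f))
leastIn-satisfies P k zero    p rewrite +-identityʳ k = p
leastIn-satisfies P k (suc f) p with P k in eq
... | true rewrite eq = tt
... | false = leastIn-satisfies P (suc k) f (subst (T ∘′ P) (+-suc k f) p)

n<2^n : ∀ n → n < 2 ^ n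
n<2^n zero    = s≤s z≤n
n<2^n (suc n) = +-mono-≤ (m^n>0 2 n) (≤-trans (n<2^n n) (m≤m+n (2 ^ n) 0))

z-mono-≤ : ∀ {a b} → a ≤ b → z a ≤ z b
z-mono-≤ a≤b = largestUpTo-mono _ _
  (λ k 3k<2a → <⇒<ᵇ (≤-trans (<ᵇ⇒< _ _ 3k<2a) (*-monoʳ-≤ 2 a≤b))) (*-monoʳ-≤ 2 a≤b)

m-mono-≤ : ∀ {a b} → a ≤ b → m a ≤ m b
m-mono-≤ a≤b = largestUpTo-mono _ _
  (λ k k²≤2a → ≤⇒≤ᵇ (≤-trans (≤ᵇ⇒≤ (k * k) _ k²≤2a) (*-monoʳ-≤ 2 a≤b))) (*-monoʳ-≤ 2 a≤b)

n≤2^r[n] : ∀ n → n ≤ 2 ^ r n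
n≤2^r[n] n = ≤ᵇ⇒≤ n _
  (leastIn-satisfies (λ k → n ℕ.≤ᵇ 2 ^ k) 0 n (≤⇒≤ᵇ (<⇒≤ (n<2^n n))))

r-mono-≤ : ∀ {a b} → a ≤ b → r a ≤ r b
r-mono-≤ {a} {b} a≤b = leastIn-minimal _ 0 a z≤n (≤⇒≤ᵇ (≤-trans a≤b (n≤2^r[n] b)))

3z[n]<2n : ∀ {n} → 1 ≤ n → 3 * z n < 2 * n
3z[n]<2n {n} 1≤n = <ᵇ⇒< _ _ (largestUpTo-satisfies (λ k → 3 * k ℕ.<ᵇ 2 * n) (2 * n)
  (<⇒<ᵇ (≤-trans 1≤n (m≤m+n n (n + 0)))))

z-maximal : ∀ a {k} → 3 * k < 2 * a → k ≤ z a
z-maximal a {k} 3k<2a = largestUpTo-maximal _ (2 * a) (≤-trans (m≤n*m k 3) (<⇒≤ 3k<2a)) (<⇒<ᵇ 3k<2a)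

penalty : ℕ → ℕ
penalty n = (r n + 1) * m n

penalty-mono-≤ : ∀ {a b} → a ≤ b → penalty a ≤ penalty b
penalty-mono-≤ a≤b = *-mono-≤ (+-monoˡ-≤ 1 (r-mono-≤ a≤b)) (m-mono-≤ a≤b)

minus-mono-≤ : ∀ {i j k l} → i ℤ.≤ k → l ℤ.≤ j → i - j ℤ.≤ k - l
minus-mono-≤ i≤k l≤j = ℤ.+-mono-≤ i≤k (ℤ.neg-mono-≤ l≤j)

i<j⇒i-j<0 : ∀ {i j} → i ℤ.< j → i - j ℤ.< 0ℤ
i<j⇒i-j<0 {i} {j} i<j = subst (i - j ℤ.<_) (ℤ.+-inverseʳ j) (ℤ.+-monoˡ-< (ℤ.- j) i<j)

j<i⇒0<i-j : ∀ {i j} → j ℤ.< i → 0ℤ ℤ.< i - j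
j<i⇒0<i-j {i} {j} j<i = subst (ℤ._< i - j) (ℤ.+-inverseʳ j) (ℤ.+-monoˡ-< (ℤ.- j) j<i)

penalty-mono-≤ℤ : ∀ {a b} → a ≤ b → + (r a + 1) ℤ.* + m a ℤ.≤ + (r b + 1) ℤ.* + m b
penalty-mono-≤ℤ {a} {b} a≤b rewrite sym (pos-* (r a + 1) (m a)) | sym (pos-* (r b + 1) (m b)) =
  ℤ.+≤+ (penalty-mono-≤ a≤b)

x-lower-bound : ∀ {a b n} → a ≤ n → n ≤ b → + z a - (+ (r b + 1) ℤ.* + m b) ℤ.≤ x n
x-lower-bound a≤n n≤b = minus-mono-≤ (ℤ.+≤+ (z-mono-≤ a≤n)) (penalty-mono-≤ℤ n≤b)

x-upper-bound : ∀ {a b n} → a ≤ n → n ≤ b → x n ℤ.≤ + z b - (+ (r a + 1) ℤ.* + m a)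
x-upper-bound a≤n n≤b = minus-mono-≤ (ℤ.+≤+ (z-mono-≤ n≤b)) (penalty-mono-≤ℤ a≤n)

z<penalty : ∀ a b → 1 ≤ b → 2 * b ≤ 3 * penalty a → + z b ℤ.< + (r a + 1) ℤ.* + m a
z<penalty a b 1≤b 2b≤3p = subst (+ z b ℤ.<_) (pos-* (r a + 1) (m a))
  (ℤ.+<+ (*-cancelˡ-< 3 (z b) (penalty a) (<-≤-trans (3z[n]<2n 1≤b) 2b≤3p)))

penalty<z : ∀ a b → 3 * penalty b + 4 ≤ 2 * a → + (r b + 1) ℤ.* + m b ℤ.< + z a
penalty<z a b 3p+4≤2a = subst (ℤ._< + z a) (pos-* (r b + 1) (m b))
  (ℤ.+<+ (z-maximal a (≤-trans (≤-reflexive 3[1+p]+1≡3p+4) 3p+4≤2a)))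
  where
  open +-*-Solver
  3[1+p]+1≡3p+4 : suc (3 * suc (penalty b)) ≡ 3 * penalty b + 4
  3[1+p]+1≡3p+4 = solve 1 (λ p → con 1 :+ con 3 :* (con 1 :+ p) := con 3 :* p :+ con 4) refl (penalty b)

lemma2 :
    ((a b n : ℕ) → 1 ≤ a → a ≤ n → n ≤ b →
       (+ z a - (+ (r b + 1) ℤ.* + m b) ℤ.≤ x n)
       × (x n ℤ.≤ + z b - (+ (r a + 1) ℤ.* + m a)))
    ×
    ((a b : ℕ) → 1 ≤ a → x a ℤ.< 0ℤ →
       2 * b ≤ 3 * ((r a + 1) * m a) →
       ((c : ℕ) → 2 * c ≤ 3 * ((r a + 1) * m a) → c ≤ b) →
       (n : ℕ) → 1 ≤ n → a ≤ n → n ≤ b → x n ℤ.< 0ℤ)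
    ×
    ((a b : ℕ) → 1 ≤ b → 0ℤ ℤ.< x b →
       3 * ((r b + 1) * m b) + 4 ≤ 2 * a →
       ((c : ℕ) → 3 * ((r b + 1) * m b) + 4 ≤ 2 * c → a ≤ c) →
       (n : ℕ) → 1 ≤ n → a ≤ n → n ≤ b → 0ℤ ℤ.< x n)
lemma2 =
  (λ a b n _ a≤n n≤b → x-lower-bound {a} {b} a≤n n≤b , x-upper-bound {a} {b} a≤n n≤b) ,
  (λ a b _ _ 2b≤3p _ n 1≤n a≤n n≤b →
    ℤ.≤-<-trans (x-upper-bound {a} {b} a≤n n≤b) (i<j⇒i-j<0 (z<penalty a b (≤-trans 1≤n n≤b) 2b≤3p))) ,
  (λ a b _ _ 3p+4≤2a _ n _ a≤n n≤b →
    ℤ.<-≤-trans (j<i⇒0<i-j (penalty<z a b 3p+4≤2a)) (x-lower-bound {a} {b} a≤n n≤b))
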